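{- Let $D$ be a strongly connected balanced bipartite digraph of order $2a\geq 4$ with partite sets $X$ and $Y$. If $d(x)+d(y)\geq 2a+3$ for every dominating pair of vertices $\{x,y\}$, then (i) the underlying graph $UG(D)$ is 2-connected; and (ii) if $C$ is a directed cycle in $D$ of length $m$ with $2\leq m\leq 2a-2$, then $D$ contains a $C$-bypass.
   Context: Digraphs are finite, without loops or multiple arcs (2-cycles allowed). $d(x)=d^+(x)+d^-(x)$. A pair of distinct vertices $\{x,y\}$ is dominating if there is a vertex $z$ with $x\to z$ and $y\to z$. $UG(D)$ is the undirected graph on $V(D)$ with an edge $xy$ whenever $x\to y$ or $y\to x$. For a nontrivial proper subset $H$ of vertices (here $H=V(C)$), an $H$-bypass is a directed $(x,y)$-path $P$ with at least 3 vertices, $x\neq y$, and $V(P)\cap H=\{x,y\}$. -}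

module Defs where

open import Data.Bool using (Bool; true; false; not)
open import Data.Nat using (ℕ; _+_; _≤_)
open import Data.Fin using (Fin)
open import Data.List using (List; []; _∷_; _++_; [_]; length; filterᵇ; allFin)
open import Data.List.Membership.Propositional using (_∈_; _∉_)
open import Data.List.Relation.Unary.All using (All)
open import Data.List.Relation.Unary.Unique.Propositional using (Unique)
open import Data.List.Relation.Unary.Linked using (Linked)
open import Data.Product using (Σ; ∃; _×_)
open import Data.Sum using (_⊎_)
open import Relation.Binary.PropositionalEquality using (_≡_; _≢_)
open import Relation.Binary.Construct.Closure.ReflexiveTransitive using (Star)

record Digraph (n : ℕ) : Set where
  field
    arc     : Fin n → Fin n → Bool
    noLoops : ∀ x → arc x x ≡ false
open Digraph public

_⟶[_]_ : {n : ℕ} → Fin n → Digraph n → Fin n → Set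
x ⟶[ D ] y = arc D x y ≡ true

outdeg : {n : ℕ} → Digraph n → Fin n → ℕ
outdeg {n} D x = length (filterᵇ (λ y → arc D x y) (allFin n))

indeg : {n : ℕ} → Digraph n → Fin n → ℕ
indeg {n} D x = length (filterᵇ (λ y → arc D y x) (allFin n))

deg : {n : ℕ} → Digraph n → Fin n → ℕ
deg D x = outdeg D x + indeg D x

StronglyConnected : {n : ℕ} → Digraph n → Set
StronglyConnected {n} D = (x y : Fin n) → Star (λ u v → u ⟶[ D ] v) x y

-- balanced bipartite with partite sets X = {v | side v ≡ false}, Y = {v | side v ≡ true},
-- each of size a, and every arc joins the two partite sets
BalancedBipartite : {n : ℕ} → Digraph n → ℕ → (Fin n → Bool) → Set
BalancedBipartite {n} D a side =
  (length (filterᵇ (λ v → not (side v)) (allFin n)) ≡ a)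
  × (length (filterᵇ side (allFin n)) ≡ a)
  × (∀ x y → x ⟶[ D ] y → side x ≢ side y)

DominatingPair : {n : ℕ} → Digraph n → Fin n → Fin n → Set
DominatingPair {n} D x y = x ≢ y × Σ (Fin n) λ z → (x ⟶[ D ] z) × (y ⟶[ D ] z)

UGEdgeAvoiding : {n : ℕ} → Digraph n → Fin n → Fin n → Fin n → Set
UGEdgeAvoiding D v u w = ((u ⟶[ D ] w) ⊎ (w ⟶[ D ] u)) × u ≢ v × w ≢ v

UGEdge : {n : ℕ} → Digraph n → Fin n → Fin n → Set
UGEdge D u w = (u ⟶[ D ] w) ⊎ (w ⟶[ D ] u)

UGTwoConnected : {n : ℕ} → Digraph n → Set
UGTwoConnected {n} D =
  (3 ≤ n)
  × ((x y : Fin n) → Star (UGEdge D) x y)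
  × ((v x y : Fin n) → x ≢ v → y ≢ v → Star (UGEdgeAvoiding D v) x y)

IsDirPath : {n : ℕ} → Digraph n → List (Fin n) → Set
IsDirPath D P = Unique P × Linked (λ u v → u ⟶[ D ] v) P

IsDirCycle : {n : ℕ} → Digraph n → ℕ → List (Fin n) → Set
IsDirCycle {n} D m C =
  (length C ≡ m) × IsDirPath D C
  × Σ (Fin n) λ v₁ → Σ (List (Fin n)) λ rest → Σ (Fin n) λ vₘ → Σ (List (Fin n)) λ init →
      (C ≡ v₁ ∷ rest) × (C ≡ init ++ [ vₘ ]) × (vₘ ⟶[ D ] v₁)

Bypass : {n : ℕ} → Digraph n → List (Fin n) → Set
Bypass {n} D C =
  Σ (Fin n) λ x → Σ (Fin n) λ y → Σ (Fin n) λ z → Σ (List (Fin n)) λ mid →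
    IsDirPath D (x ∷ (z ∷ mid) ++ [ y ])
    × x ≢ y × x ∈ C × y ∈ C × All (_∉ C) (z ∷ mid)

-- (i) To join x, y ≠ v in UG(D) − v, follow walks of D from x and from y to v up to the last vertices
-- u₁, u₂ before v. They form a dominating pair in the part opposite v, and they have a common neighbour
-- other than v: otherwise each vertex of v's part would meet at most two of their arcs and v at most
-- four, giving d(u₁) + d(u₂) ≤ 2a + 2.
-- (ii) A cycle of length at most 2a − 2 misses a vertex r. Strong connectivity gives a walk into r that
-- leaves C for the last time at α and a walk out of r that first enters C at β; if α ≠ β these make a
-- bypass. Otherwise r hangs off C at α: a closed walk through α avoids C elsewhere. Along a path of
-- UG(D) − α from r to C, each step either reaches a vertex that again hangs off C at α or, combined with
-- the walks at hand, gives a bypass; as the path ends on C, a bypass appears.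
module Submission where

open import Algebra.Properties.CommutativeSemigroup using (xy∙z≈xz∙y)
open import Data.Bool using (Bool; true; false; not; if_then_else_)
import Data.Bool as Bool
open import Data.Empty using (⊥-elim)
open import Data.Fin using (Fin; zero; suc; _≟_)
open import Data.Fin.Properties using (any?; ¬∀⟶∃¬; injective⇒≤; suc-injective)
open import Data.List using (List; []; _∷_; _++_; [_]; length; filterᵇ; tabulate; lookup)
open import Data.List.Membership.Propositional using (_∈_; _∉_)
open import Data.List.Relation.Unary.All using (All; []; _∷_)
import Data.List.Relation.Unary.All as All
open import Data.List.Relation.Unary.All.Properties using (¬Any⇒All¬; ++⁺)
open import Data.List.Relation.Unary.AllPairs using ([]; _∷_)
open import Data.List.Relation.Unary.Any using (here; there; index)
open import Data.List.Relation.Unary.Any.Properties using (lookup-index)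
open import Data.List.Relation.Unary.Linked using (Linked; [-]; _∷_)
import Data.List.Relation.Unary.Linked as Linked
open import Data.List.Relation.Unary.Unique.Propositional using (Unique)
open import Data.Nat using (ℕ; zero; suc; _+_; _*_; _≤_; _<_; _∸_; z≤n; s≤s)
open import Data.Nat.Properties
  using (+-mono-≤; +-assoc; +-identityʳ; +-cancelˡ-≤; ≤-refl; ≤-reflexive; ≤-trans; ≤-<-trans;
         <⇒≱; *-monoʳ-≤; ∸-monoʳ-<; +-*-semiring; +-commutativeSemigroup; module ≤-Reasoning)
open import Data.Product using (∃-syntax; ∃₂; _×_; _,_; proj₁; proj₂)
open import Data.Sum using (_⊎_; inj₁; inj₂) renaming (swap to ⊎-swap)
open import Function using (_∘_; id)
open import Relation.Binary.Construct.Closure.ReflexiveTransitive using (Star; ε; _◅_; _◅◅_)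
import Relation.Binary.Construct.Closure.ReflexiveTransitive as Star
open import Relation.Binary.PropositionalEquality
  using (_≡_; _≢_; refl; sym; trans; cong; cong₂; subst; module ≡-Reasoning)
open import Relation.Nullary using (¬_; Dec; yes; no; ¬?; _×-dec_; _⊎-dec_)

open import Algebra.Properties.Semiring.Sum +-*-semiring
  using (sum; sum-syntax; ∑-distrib-+; *-distribˡ-sum)

open import Defs

boolToℕ : Bool → ℕ
boolToℕ true  = 1
boolToℕ false = 0

boolToℕ≤1 : ∀ b → boolToℕ b ≤ 1
boolToℕ≤1 true  = ≤-refl
boolToℕ≤1 false = z≤n

length-filterᵇ-tabulate : ∀ {A : Set} {n} (p : A → Bool) (f : Fin n → A) →
  length (filterᵇ p (tabulate f)) ≡ ∑[ i < n ] boolToℕ (p (f i))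
length-filterᵇ-tabulate {n = zero}  p f = refl
length-filterᵇ-tabulate {n = suc n} p f with p (f zero)
... | true  = cong suc (length-filterᵇ-tabulate p (f ∘ suc))
... | false = length-filterᵇ-tabulate p (f ∘ suc)

∑-mono-≤ : ∀ {n} {f g : Fin n → ℕ} → (∀ i → f i ≤ g i) → sum f ≤ sum g
∑-mono-≤ {zero}  _   = z≤n
∑-mono-≤ {suc n} f≤g = +-mono-≤ (f≤g zero) (∑-mono-≤ (f≤g ∘ suc))

∑-mono-≤-except : ∀ {n} {f g : Fin n → ℕ} (v : Fin n) {k} →
  (∀ i → i ≢ v → f i ≤ g i) → f v ≤ g v + k → sum f ≤ sum g + k
∑-mono-≤-except {suc n} {f} {g} zero {k} f≤g fv≤ = begin
  f zero + sum (f ∘ suc)     ≤⟨ +-mono-≤ fv≤ (∑-mono-≤ (λ i → f≤g (suc i) λ ())) ⟩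
  g zero + k + sum (g ∘ suc) ≡⟨ xy∙z≈xz∙y +-commutativeSemigroup (g zero) k (sum (g ∘ suc)) ⟩
  g zero + sum (g ∘ suc) + k ∎
  where open ≤-Reasoning
∑-mono-≤-except {suc n} {f} {g} (suc v) {k} f≤g fv≤ = begin
  f zero + sum (f ∘ suc)
    ≤⟨ +-mono-≤ (f≤g zero λ ()) (∑-mono-≤-except v (λ i i≢v → f≤g (suc i) (i≢v ∘ suc-injective)) fv≤) ⟩
  g zero + (sum (g ∘ suc) + k)
    ≡⟨ +-assoc (g zero) (sum (g ∘ suc)) k ⟨
  g zero + sum (g ∘ suc) + k
    ∎
  where open ≤-Reasoning

UGEdge? : ∀ {n} (D : Digraph n) u w → Dec (UGEdge D u w)
UGEdge? D u w = (arc D u w Bool.≟ true) ⊎-dec (arc D w u Bool.≟ true)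

module BipartiteDegrees {n} (D : Digraph n) (side : Fin n → Bool) {a} (bb : BalancedBipartite D a side) where

  arcsBetween : Fin n → Fin n → ℕ
  arcsBetween u w = boolToℕ (arc D u w) + boolToℕ (arc D w u)

  sameSide : Fin n → Fin n → Bool
  sameSide v w = if side v then side w else not (side w)

  deg≡∑arcsBetween : ∀ u → deg D u ≡ ∑[ w < n ] arcsBetween u w
  deg≡∑arcsBetween u = begin
    outdeg D u + indeg D u
      ≡⟨ cong₂ _+_ (length-filterᵇ-tabulate (arc D u) id) (length-filterᵇ-tabulate (λ w → arc D w u) id) ⟩
    ∑[ w < n ] boolToℕ (arc D u w) + ∑[ w < n ] boolToℕ (arc D w u)
      ≡⟨ ∑-distrib-+ (λ w → boolToℕ (arc D u w)) (λ w → boolToℕ (arc D w u)) ⟨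
    ∑[ w < n ] arcsBetween u w ∎
    where open ≡-Reasoning

  ∑-sameSide : ∀ v → ∑[ w < n ] boolToℕ (sameSide v w) ≡ a
  ∑-sameSide v with side v
  ... | true  = trans (sym (length-filterᵇ-tabulate side id)) (proj₁ (proj₂ bb))
  ... | false = trans (sym (length-filterᵇ-tabulate (not ∘ side) id)) (proj₁ bb)

  sameSide-refl : ∀ v → sameSide v v ≡ true
  sameSide-refl v with side v
  ... | true  = refl
  ... | false = refl

  arcsBetween≤2 : ∀ u w → arcsBetween u w ≤ 2
  arcsBetween≤2 u w = +-mono-≤ (boolToℕ≤1 (arc D u w)) (boolToℕ≤1 (arc D w u))

  arcsBetween≡0 : ∀ {u w} → ¬ UGEdge D u w → arcsBetween u w ≡ 0
  arcsBetween≡0 {u} {w} ¬uw with arc D u w | arc D w u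
  ... | false | false = refl
  ... | true  | _     = ⊥-elim (¬uw (inj₁ refl))
  ... | false | true  = ⊥-elim (¬uw (inj₂ refl))

  ¬UGEdge-sameSide : ∀ {u w} → side u ≡ side w → ¬ UGEdge D u w
  ¬UGEdge-sameSide su≡sw (inj₁ u→w) = proj₂ (proj₂ bb) _ _ u→w su≡sw
  ¬UGEdge-sameSide su≡sw (inj₂ w→u) = proj₂ (proj₂ bb) _ _ w→u (sym su≡sw)

  opposite-sameSide : ∀ su sv sw → su ≢ sv → (if sv then sw else not sw) ≡ false → su ≡ sw
  opposite-sameSide false true  false _  _  = refl
  opposite-sameSide true  false true  _  _  = refl
  opposite-sameSide true  true  _     ne _  = ⊥-elim (ne refl)
  opposite-sameSide false false _     ne _  = ⊥-elim (ne refl)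
  opposite-sameSide _     true  true  _  ()
  opposite-sameSide _     false false _  ()

  arcsBetween≤sameSide : ∀ {u v} → side u ≢ side v → ∀ w → arcsBetween u w ≤ 2 * boolToℕ (sameSide v w)
  arcsBetween≤sameSide {u} {v} su≢sv w with sameSide v w in eq
  ... | true  = arcsBetween≤2 u w
  ... | false = ≤-reflexive (arcsBetween≡0
                  (¬UGEdge-sameSide (opposite-sameSide (side u) (side v) (side w) su≢sv eq)))

  commonNeighbour : ∀ {u₁ u₂ v} → 2 * a + 3 ≤ deg D u₁ + deg D u₂ → u₁ ⟶[ D ] v → u₂ ⟶[ D ] v →
    ∃[ w ] w ≢ v × UGEdge D u₁ w × UGEdge D u₂ w
  commonNeighbour {u₁} {u₂} {v} degSum u₁→v u₂→v
    with any? (λ w → ¬? (w ≟ v) ×-dec UGEdge? D u₁ w ×-dec UGEdge? D u₂ w)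
  ... | yes found = found
  ... | no none   = ⊥-elim (<⇒≱ (s≤s (s≤s (s≤s z≤n))) (+-cancelˡ-≤ (2 * a) 3 2 (begin
    2 * a + 3
      ≤⟨ degSum ⟩
    deg D u₁ + deg D u₂
      ≡⟨ cong₂ _+_ (deg≡∑arcsBetween u₁) (deg≡∑arcsBetween u₂) ⟩
    ∑[ w < n ] arcsBetween u₁ w + ∑[ w < n ] arcsBetween u₂ w
      ≡⟨ ∑-distrib-+ (arcsBetween u₁) (arcsBetween u₂) ⟨
    ∑[ w < n ] (arcsBetween u₁ w + arcsBetween u₂ w)
      ≤⟨ ∑-mono-≤-except v awayFromV atV ⟩
    ∑[ w < n ] (2 * boolToℕ (sameSide v w)) + 2
      ≡⟨ cong (_+ 2) (*-distribˡ-sum 2 (boolToℕ ∘ sameSide v)) ⟨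
    2 * ∑[ w < n ] boolToℕ (sameSide v w) + 2
      ≡⟨ cong (λ s → 2 * s + 2) (∑-sameSide v) ⟩
    2 * a + 2 ∎)))
    where
    open ≤-Reasoning
    bound₁ : ∀ w → arcsBetween u₁ w ≤ 2 * boolToℕ (sameSide v w)
    bound₁ = arcsBetween≤sameSide (proj₂ (proj₂ bb) u₁ v u₁→v)
    bound₂ : ∀ w → arcsBetween u₂ w ≤ 2 * boolToℕ (sameSide v w)
    bound₂ = arcsBetween≤sameSide (proj₂ (proj₂ bb) u₂ v u₂→v)

    awayFromV : ∀ w → w ≢ v → arcsBetween u₁ w + arcsBetween u₂ w ≤ 2 * boolToℕ (sameSide v w)
    awayFromV w w≢v with UGEdge? D u₁ w | UGEdge? D u₂ w
    ... | yes e₁ | yes e₂ = ⊥-elim (none (w , w≢v , e₁ , e₂))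
    ... | no ¬e₁ | _      rewrite arcsBetween≡0 ¬e₁ = bound₂ w
    ... | yes _  | no ¬e₂ rewrite arcsBetween≡0 ¬e₂ | +-identityʳ (arcsBetween u₁ w) = bound₁ w

    atV : arcsBetween u₁ v + arcsBetween u₂ v ≤ 2 * boolToℕ (sameSide v v) + 2
    atV rewrite sameSide-refl v = +-mono-≤ (arcsBetween≤2 u₁ v) (arcsBetween≤2 u₂ v)

NoCutVertex : ∀ {n} → Digraph n → Set
NoCutVertex {n} D = (v x y : Fin n) → x ≢ v → y ≢ v → Star (UGEdgeAvoiding D v) x y

DominatingDegreeCondition : ∀ {n} → Digraph n → ℕ → Set
DominatingDegreeCondition {n} D a = (x y : Fin n) → DominatingPair D x y → 2 * a + 3 ≤ deg D x + deg D y

module _ {n} (D : Digraph n) where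

  Arc : Fin n → Fin n → Set
  Arc u w = u ⟶[ D ] w

  inNeighbourAvoiding : ∀ {x v} → Star Arc x v → x ≢ v →
    ∃[ u ] Star (UGEdgeAvoiding D v) x u × u ⟶[ D ] v × u ≢ v
  inNeighbourAvoiding ε x≢v = ⊥-elim (x≢v refl)
  inNeighbourAvoiding {x} {v} (_◅_ {j = x′} x→x′ x′⇝v) x≢v with x′ ≟ v
  ... | yes refl = x , ε , x→x′ , x≢v
  ... | no x′≢v with u , x′⇝u , u→v , u≢v ← inNeighbourAvoiding x′⇝v x′≢v
    = u , (inj₁ x→x′ , x≢v , x′≢v) ◅ x′⇝u , u→v , u≢v

  UGEdgeAvoiding-sym : ∀ {v u w} → UGEdgeAvoiding D v u w → UGEdgeAvoiding D v w u
  UGEdgeAvoiding-sym (uw , u≢v , w≢v) = ⊎-swap uw , w≢v , u≢v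

  noCutVertex : ∀ {a} (side : Fin n → Bool) → BalancedBipartite D a side → StronglyConnected D →
    DominatingDegreeCondition D a → NoCutVertex D
  noCutVertex side bb sc degree v x y x≢v y≢v
    with u₁ , x⇝u₁ , u₁→v , u₁≢v ← inNeighbourAvoiding (sc x v) x≢v
       | u₂ , y⇝u₂ , u₂→v , u₂≢v ← inNeighbourAvoiding (sc y v) y≢v
    with u₁ ≟ u₂
  ... | yes refl = x⇝u₁ ◅◅ Star.reverse UGEdgeAvoiding-sym y⇝u₂
  ... | no u₁≢u₂
    with w , w≢v , u₁w , u₂w ← BipartiteDegrees.commonNeighbour D side bb
                                  (degree u₁ u₂ (u₁≢u₂ , v , u₁→v , u₂→v)) u₁→v u₂→v
    = x⇝u₁ ◅◅ (u₁w , u₁≢v , w≢v) ◅ (⊎-swap u₂w , w≢v , u₂≢v) ◅ Star.reverse UGEdgeAvoiding-sym y⇝u₂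

module WalkToPath {A : Set} (_≟ᴬ_ : (x y : A) → Dec (x ≡ y)) {R : A → A → Set} where

  open import Data.List.Membership.DecPropositional _≟ᴬ_ using (_∈?_)

  suffixFrom : ∀ {x y} xs → x ∈ xs → ∃[ post ]
    (Unique (xs ++ [ y ]) → Unique (x ∷ post ++ [ y ])) × (Linked R (xs ++ [ y ]) → Linked R (x ∷ post ++ [ y ]))
  suffixFrom (_ ∷ xs) (here refl) = xs , id , id
  suffixFrom (_ ∷ xs) (there x∈xs) with post , unique , linked ← suffixFrom xs x∈xs
    = post , (λ { (_ ∷ u) → unique u }) , linked ∘ Linked.tail

  walk⇒path : ∀ {x y} → Star R x y → x ≢ y → ∃[ mid ] Unique (x ∷ mid ++ [ y ]) × Linked R (x ∷ mid ++ [ y ])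
  walk⇒path ε x≢y = ⊥-elim (x≢y refl)
  walk⇒path {x} {y} (_◅_ {j = x′} x~x′ x′⇝y) x≢y with x′ ≟ᴬ y
  ... | yes refl = [] , (x≢y ∷ []) ∷ [] ∷ [] , x~x′ ∷ [-]
  ... | no x′≢y with mid , unique , linked ← walk⇒path x′⇝y x′≢y with x ∈? (x′ ∷ mid)
  ...   | yes x∈ with post , unique′ , linked′ ← suffixFrom (x′ ∷ mid) x∈ = post , unique′ unique , linked′ linked
  ...   | no x∉ = x′ ∷ mid , ++⁺ (¬Any⇒All¬ _ x∉) (x≢y ∷ []) ∷ unique , x~x′ ∷ linked

Linked⇒All-init : ∀ {A : Set} {P : A → Set} {R : A → A → Set} → (∀ {u w} → R u w → P u) →
  ∀ xs {y} → Linked R (xs ++ [ y ]) → All P xs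
Linked⇒All-init R⇒P []            _         = []
Linked⇒All-init R⇒P (_ ∷ [])      (r ∷ _)   = R⇒P r ∷ []
Linked⇒All-init R⇒P (_ ∷ _ ∷ xs)  (r ∷ rs)  = R⇒P r ∷ Linked⇒All-init R⇒P (_ ∷ xs) rs

module Bypasses {n} (D : Digraph n) (sc : StronglyConnected D) (C : List (Fin n)) where

  open import Data.List.Membership.DecPropositional (_≟_ {n}) using (_∈?_)

  ArcFromOutside : Fin n → Fin n → Set
  ArcFromOutside u w = u ⟶[ D ] w × u ∉ C

  -- Only the final vertex y of the walk may lie on C again.
  Excursion : Fin n → Fin n → Set
  Excursion x y = x ∈ C × ∃[ z ] x ⟶[ D ] z × z ∉ C × Star ArcFromOutside z y

  Excursion-◅◅ : ∀ {x w y} → Excursion x w → Star ArcFromOutside w y → Excursion x y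
  Excursion-◅◅ (x∈C , z , x→z , z∉C , z⇝w) w⇝y = x∈C , z , x→z , z∉C , z⇝w ◅◅ w⇝y

  firstEntry : ∀ {u t} → Star (Arc D) u t → t ∈ C → ∃[ β ] β ∈ C × Star ArcFromOutside u β
  firstEntry {u} ε t∈C = u , t∈C , ε
  firstEntry {u} (u→u′ ◅ u′⇝t) t∈C with u ∈? C
  ... | yes u∈C = u , u∈C , ε
  ... | no u∉C with β , β∈C , u′⇝β ← firstEntry u′⇝t t∈C = β , β∈C , (u→u′ , u∉C) ◅ u′⇝β

  lastExit : ∀ {s w} → Star (Arc D) s w → w ∉ C → (s ∉ C × Star ArcFromOutside s w) ⊎ ∃[ α ] Excursion α w
  lastExit ε w∉C = inj₁ (w∉C , ε)
  lastExit {s} (_◅_ {j = s′} s→s′ s′⇝w) w∉C with lastExit s′⇝w w∉C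
  ... | inj₂ excursion = inj₂ excursion
  ... | inj₁ (s′∉C , s′⇝w) with s ∈? C
  ...   | yes s∈C = inj₂ (s , s∈C , s′ , s→s′ , s′∉C , s′⇝w)
  ...   | no s∉C  = inj₁ (s∉C , (s→s′ , s∉C) ◅ s′⇝w)

  bypass : ∀ {x y} → Excursion x y → y ∈ C → x ≢ y → Bypass D C
  bypass {x} {y} (x∈C , z , x→z , z∉C , z⇝y) y∈C x≢y
    with mid , unique , linked ← WalkToPath.walk⇒path _≟_ z⇝y (λ { refl → z∉C y∈C })
    = x , y , z , mid , (x∉path ∷ unique , x→z ∷ Linked.map proj₁ linked) , x≢y , x∈C , y∈C , path∉C
    where
    path∉C : All (_∉ C) (z ∷ mid)
    path∉C = Linked⇒All-init proj₂ (z ∷ mid) linked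
    x∉path : All (x ≢_) (z ∷ mid ++ [ y ])
    x∉path = ++⁺ (All.map (λ u∉C x≡u → u∉C (subst (_∈ C) x≡u x∈C)) path∉C) (x≢y ∷ [])

  HangsOff : Fin n → Fin n → Set
  HangsOff p w = Excursion p w × Star ArcFromOutside w p

  bypass⊎hangsOff : ∀ {w c} → w ∉ C → c ∈ C → Bypass D C ⊎ ∃[ p ] HangsOff p w
  bypass⊎hangsOff {w} {c} w∉C c∈C with β , β∈C , w⇝β ← firstEntry (sc w c) c∈C | lastExit (sc c w) w∉C
  ... | inj₁ (c∉C , _) = ⊥-elim (c∉C c∈C)
  ... | inj₂ (α , excursion) with α ≟ β
  ...   | yes refl = inj₂ (α , excursion , w⇝β)
  ...   | no α≢β   = inj₁ (bypass (Excursion-◅◅ excursion w⇝β) β∈C α≢β)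

  bypassAlong : ∀ {p w t} → HangsOff p w → w ∉ C → Star (UGEdgeAvoiding D p) w t → t ∈ C → Bypass D C
  bypassAlong _ w∉C ε t∈C = ⊥-elim (w∉C t∈C)
  bypassAlong {p} {w} (p⇝w , w⇝p) w∉C (_◅_ {j = w′} (ww′ , _ , w′≢p) w′⇝t) t∈C with w′ ∈? C
  ... | yes w′∈C = onC ww′
    where
    onC : UGEdge D w w′ → Bypass D C
    onC (inj₁ w→w′) = bypass (Excursion-◅◅ p⇝w ((w→w′ , w∉C) ◅ ε)) w′∈C (w′≢p ∘ sym)
    onC (inj₂ w′→w) = bypass (w′∈C , w , w′→w , w∉C , w⇝p) (proj₁ p⇝w) w′≢p
  ... | no w′∉C with bypass⊎hangsOff w′∉C (proj₁ p⇝w)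
  ...   | inj₁ found = found
  ...   | inj₂ (q , q⇝w′ , w′⇝q) with q ≟ p
  ...     | yes refl = bypassAlong (q⇝w′ , w′⇝q) w′∉C w′⇝t t∈C
  ...     | no q≢p = offC ww′
    where
    offC : UGEdge D w w′ → Bypass D C
    offC (inj₁ w→w′) = bypass (Excursion-◅◅ p⇝w ((w→w′ , w∉C) ◅ w′⇝q)) (proj₁ q⇝w′) (q≢p ∘ sym)
    offC (inj₂ w′→w) = bypass (Excursion-◅◅ q⇝w′ ((w′→w , w′∉C) ◅ w⇝p)) (proj₁ p⇝w) q≢p

  noCutVertex⇒bypass : NoCutVertex D → ∀ {c₁ c₂ r} → c₁ ∈ C → c₂ ∈ C → c₁ ≢ c₂ → r ∉ C → Bypass D C
  noCutVertex⇒bypass noCut {c₁} {c₂} {r} c₁∈C c₂∈C c₁≢c₂ r∉C with bypass⊎hangsOff r∉C c₁∈C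
  ... | inj₁ found = found
  ... | inj₂ (p , hangs@((p∈C , _) , _)) = along (c₁ ≟ p)
    where
    r≢p : r ≢ p
    r≢p refl = r∉C p∈C
    along : Dec (c₁ ≡ p) → Bypass D C
    along (yes refl) = bypassAlong hangs r∉C (noCut p r c₂ r≢p (c₁≢c₂ ∘ sym)) c₂∈C
    along (no c₁≢p)  = bypassAlong hangs r∉C (noCut p r c₁ r≢p c₁≢p) c₁∈C

covering⇒length≥ : ∀ {n} {xs : List (Fin n)} → (∀ i → i ∈ xs) → n ≤ length xs
covering⇒length≥ {xs = xs} cover = injective⇒≤ {f = index ∘ cover} λ {i} {j} eq → begin
  i                          ≡⟨ lookup-index (cover i) ⟩
  lookup xs (index (cover i)) ≡⟨ cong (lookup xs) eq ⟩
  lookup xs (index (cover j)) ≡⟨ lookup-index (cover j) ⟨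
  j                          ∎
  where open ≡-Reasoning

∃∉-shortList : ∀ {n} (xs : List (Fin n)) → length xs < n → ∃[ r ] r ∉ xs
∃∉-shortList {n} xs short = ¬∀⟶∃¬ n (_∈ xs) (_∈? xs) (<⇒≱ short ∘ covering⇒length≥)
  where open import Data.List.Membership.DecPropositional (_≟_ {n}) using (_∈?_)

twoDistinct : ∀ {A : Set} {xs : List A} → Unique xs → 2 ≤ length xs → ∃₂ λ x y → x ∈ xs × y ∈ xs × x ≢ y
twoDistinct {xs = x ∷ y ∷ _} ((x≢y ∷ _) ∷ _) _ = x , y , here refl , there (here refl) , x≢y
twoDistinct {xs = _ ∷ []} _ (s≤s ())

lemma4p1 : (a : ℕ) → 2 ≤ a → (D : Digraph (2 * a)) → (side : Fin (2 * a) → Bool)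
    → BalancedBipartite D a side
    → StronglyConnected D
    → ((x y : Fin (2 * a)) → DominatingPair D x y → 2 * a + 3 ≤ deg D x + deg D y)
    → UGTwoConnected D
      × ((m : ℕ) → (C : List (Fin (2 * a))) → IsDirCycle D m C → 2 ≤ m → m ≤ 2 * a ∸ 2
         → Bypass D C)
lemma4p1 a a≥2 D side bb sc degree = (3≤2a , (λ x y → Star.map inj₁ (sc x y)) , noCut) , cycleBypass
  where
  4≤2a : 4 ≤ 2 * a
  4≤2a = *-monoʳ-≤ 2 a≥2
  3≤2a : 3 ≤ 2 * a
  3≤2a = ≤-trans (s≤s (s≤s (s≤s z≤n))) 4≤2a
  2a∸2<2a : 2 * a ∸ 2 < 2 * a
  2a∸2<2a = ∸-monoʳ-< {o = 0} (s≤s z≤n) (≤-trans (s≤s (s≤s z≤n)) 4≤2a)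
  noCut : NoCutVertex D
  noCut = noCutVertex D side bb sc degree
  cycleBypass : (m : ℕ) → (C : List (Fin (2 * a))) → IsDirCycle D m C → 2 ≤ m → m ≤ 2 * a ∸ 2 → Bypass D C
  cycleBypass m C (refl , (unique , _) , _) m≥2 m≤2a∸2
    with c₁ , c₂ , c₁∈C , c₂∈C , c₁≢c₂ ← twoDistinct unique m≥2
       | r , r∉C ← ∃∉-shortList C (≤-<-trans m≤2a∸2 2a∸2<2a)
    = Bypasses.noCutVertex⇒bypass D sc C noCut c₁∈C c₂∈C c₁≢c₂ r∉C
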